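{- Let $\mathsf{K}$ be a class of $\mathcal{L}$-lattices closed under taking subalgebras and direct powers, and let $T\cup\{\varphi\approx\psi\}$ be a set of $\mathrm{Fm}^1_\forall(\mathcal{L})$-equations. Then $T^\ast\models_{\mathsf{mK}}\varphi^\ast\approx\psi^\ast$ implies $T\models^{\forall}_{\mathsf{K}}\varphi\approx\psi$. Moreover, if every member of $\mathsf{mK}$ is $\mathsf{K}$-functional, then $T^\ast\models_{\mathsf{mK}}\varphi^\ast\approx\psi^\ast$ if and only if $T\models^{\forall}_{\mathsf{K}}\varphi\approx\psi$.
   Context: $\mathcal{L}$ is a lattice-oriented signature: an algebraic signature (with $\mathcal{L}_n$ its $n$-ary operation symbols) containing distinct binary symbols $\land,\lor$. An $\mathcal{L}$-lattice is an algebra of signature $\mathcal{L}$ whose $\{\land,\lor\}$-reduct is a lattice. An m-lattice is an algebra $\langle L,\land,\lor,\Box,\Diamond\rangle$ with lattice reduct satisfying $\Box x\land x\approx \Box x$, $\Box(x\land y)\approx\Box x\land\Box y$, $\Box\Diamond x\approx\Diamond x$, $\Diamond x\lor x\approx\Diamond x$, $\Diamond(x\lor y)\approx\Diamond x\lor\Diamond y$, $\Diamond\Box x\approx\Box x$; an m-$\mathcal{L}$-lattice is $\langle\mathbf{A},\Box,\Diamond\rangle$ with $\mathbf{A}$ an $\mathcal{L}$-lattice, $\langle A,\land,\lor,\Box,\Diamond\rangle$ an m-lattice, and $\Box(\star(\Box x_1,\dots,\Box x_n))\approx\star(\Box x_1,\dots,\Box x_n)$ for all $\star\in\mathcal{L}_n$.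 $\mathsf{mK}$ is the class of m-$\mathcal{L}$-lattices whose $\mathcal{L}$-lattice reduct is in $\mathsf{K}$. An $\langle\mathbf{A},W\rangle$-functional m-$\mathcal{L}$-lattice ($\mathbf{A}$ an $\mathcal{L}$-lattice, $W$ a set) is $\langle\mathbf{B},\Box,\Diamond\rangle$ with $\mathbf{B}$ a subalgebra of $\mathbf{A}^W$ (pointwise operations) such that for each $f\in B$, $\bigwedge_{v\in W}f(v)$ and $\bigvee_{v\in W}f(v)$ exist in $\mathbf{A}$ and the constant functions $\Box f\colon u\mapsto\bigwedge_{v}f(v)$, $\Diamond f\colon u\mapsto\bigvee_vf(v)$ lie in $B$. An m-$\mathcal{L}$-lattice is $\mathsf{K}$-functional if it is isomorphic to an $\langle\mathbf{A},W\rangle$-functional m-$\mathcal{L}$-lattice for some $\mathbf{A}\in\mathsf{K}$ and set $W$. $\mathrm{Fm}^1_\forall(\mathcal{L})$: one-variable formulas built from unary predicates $P_i$ ($i\in\mathbb{N}$) applied to a single variable $x$, connectives of $\mathcal{L}$, and $\forall x,\exists x$; an $\mathrm{Fm}^1_\forall(\mathcal{L})$-equation is a pair $\varphi\approx\psi$ of such formulas. For an $\mathcal{L}$-lattice $\mathbf{A}$, non-empty set $S$ and maps $\mathcal{I}(P_i)\colon S\to A$, $\mathcal{S}=\langle S,\mathcal{I}\rangle$ is an $\mathbf{A}$-structure if the partial map $[\![\cdot]\!]^{\mathcal{S}}\colon\mathrm{Fm}^1_\forall(\mathcal{L})\to A^S$ with $[\![P_i(x)]\!]^{\mathcal{S}}=\mathcal{I}(P_i)$,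 connectives interpreted pointwise, $[\![\forall x\varphi]\!]^{\mathcal{S}}(u)=\bigwedge_{v\in S}[\![\varphi]\!]^{\mathcal{S}}(v)$, $[\![\exists x\varphi]\!]^{\mathcal{S}}(u)=\bigvee_{v\in S}[\![\varphi]\!]^{\mathcal{S}}(v)$ is total. $\mathcal{S}\models\varphi\approx\psi$ means $[\![\varphi]\!]^{\mathcal{S}}=[\![\psi]\!]^{\mathcal{S}}$. $T\models^\forall_{\mathsf{K}}\varphi\approx\psi$ means: for every $\mathbf{A}\in\mathsf{K}$ and every $\mathbf{A}$-structure $\mathcal{S}$, if $\mathcal{S}$ validates all equations of $T$ then $\mathcal{S}\models\varphi\approx\psi$. $\mathrm{Fm}_\Box(\mathcal{L})$ is the set of propositional formulas from variables $p_i$, connectives of $\mathcal{L}$ and unary $\Box,\Diamond$; the translation $(\cdot)^\ast$ sends $P_i(x)\mapsto p_i$, commutes with connectives of $\mathcal{L}$, and sends $\forall x\varphi\mapsto\Box\varphi^\ast$, $\exists x\varphi\mapsto\Diamond\varphi^\ast$, extended to equations and sets of equations. For a class $\mathsf{V}$ of algebras in signature $\mathcal{L}\cup\{\Box,\Diamond\}$, $\Sigma\models_{\mathsf{V}}\alpha\approx\beta$ means that for every $\mathbf{B}\in\mathsf{V}$ and every homomorphism $f$ from the formula algebra on $\mathrm{Fm}_\Box(\mathcal{L})$ to $\mathbf{B}$ with $f(\alpha')=f(\beta')$ for all $\alpha'\approx\beta'\in\Sigma$, also $f(\alpha)=f(\beta)$. -}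

module Defs where

open import Level using (Level; _⊔_) renaming (suc to lsuc)
open import Data.Nat using (ℕ; suc)
open import Data.Fin using (Fin; zero; suc)
open import Data.Vec.Functional using ([]; _∷_)
open import Data.Product using (Σ; Σ-syntax; _×_; _,_; proj₁; proj₂)
open import Function.Bundles using (_⇔_)
open import Relation.Binary.Core using (Rel)
open import Relation.Binary.Structures using (IsEquivalence)
open import Relation.Binary.PropositionalEquality using (_≡_; _≢_; refl)
open import Algebra.Lattice.Structures using (IsLattice)

record Signature : Set₁ where
  field
    Op        : ℕ → Set
    meet      : Op 2
    join      : Op 2
    meet≢join : meet ≢ join

module _ (𝓛 : Signature) where
  open Signature 𝓛

  -- 𝓛-lattices (setoid-based algebras: _≈_ plays the role of equality,
  -- and every operation respects it), whose {∧,∨}-reduct is a lattice.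

  record LLattice (a : Level) : Set (lsuc a) where
    field
      Carrier   : Set a
      _≈_       : Rel Carrier a
      ⟦_⟧       : ∀ {n} → Op n → (Fin n → Carrier) → Carrier
      ⟦⟧-cong   : ∀ {n} (o : Op n) (xs ys : Fin n → Carrier) →
                  (∀ i → xs i ≈ ys i) → ⟦ o ⟧ xs ≈ ⟦ o ⟧ ys
      isLattice : IsLattice _≈_ (λ x y → ⟦ join ⟧ (x ∷ y ∷ []))
                                (λ x y → ⟦ meet ⟧ (x ∷ y ∷ []))

    _∧_ : Carrier → Carrier → Carrier
    x ∧ y = ⟦ meet ⟧ (x ∷ y ∷ [])

    _∨_ : Carrier → Carrier → Carrier
    x ∨ y = ⟦ join ⟧ (x ∷ y ∷ [])

    open IsLattice isLattice public

    _≤_ : Carrier → Carrier → Set a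
    x ≤ y = (x ∧ y) ≈ x

    IsInf : ∀ {W : Set a} → (W → Carrier) → Carrier → Set a
    IsInf {W} f m = (∀ v → m ≤ f v) × (∀ z → (∀ v → z ≤ f v) → z ≤ m)

    IsSup : ∀ {W : Set a} → (W → Carrier) → Carrier → Set a
    IsSup {W} f m = (∀ v → f v ≤ m) × (∀ z → (∀ v → f v ≤ z) → m ≤ z)

    private
      module E = IsEquivalence isEquivalence

    two : ∀ (o : Op 2) (xs : Fin 2 → Carrier) →
          ⟦ o ⟧ xs ≈ ⟦ o ⟧ (xs zero ∷ xs (suc zero) ∷ [])
    two o xs = ⟦⟧-cong o _ _ λ { zero → E.refl ; (suc zero) → E.refl }

  module _ {a : Level} (A : LLattice a) where
    private module A = LLattice A
    open A using (Carrier; _≈_; ⟦_⟧; two)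
    private module E = IsEquivalence A.isEquivalence

    Pow : (W : Set a) → LLattice a
    Pow W = record
      { Carrier   = W → Carrier
      ; _≈_       = λ f g → ∀ w → f w ≈ g w
      ; ⟦_⟧       = λ o fs w → ⟦ o ⟧ (λ i → fs i w)
      ; ⟦⟧-cong   = λ o fs gs e w → A.⟦⟧-cong o _ _ (λ i → e i w)
      ; isLattice = record
        { isEquivalence = record
          { refl  = λ w → E.refl
          ; sym   = λ e w → E.sym (e w)
          ; trans = λ e₁ e₂ w → E.trans (e₁ w) (e₂ w) }
        ; ∨-comm  = λ f g w → E.trans (two join _)
                     (E.trans (A.∨-comm (f w) (g w)) (E.sym (two join _)))
        ; ∨-assoc = λ f g h w → E.trans (two join _)
                     (E.trans (A.∨-cong (two join _) E.refl)
                     (E.trans (A.∨-assoc (f w) (g w) (h w))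
                     (E.trans (A.∨-cong E.refl (E.sym (two join _)))
                     (E.sym (two join _)))))
        ; ∨-cong  = λ e₁ e₂ w → E.trans (two join _)
                     (E.trans (A.∨-cong (e₁ w) (e₂ w)) (E.sym (two join _)))
        ; ∧-comm  = λ f g w → E.trans (two meet _)
                     (E.trans (A.∧-comm (f w) (g w)) (E.sym (two meet _)))
        ; ∧-assoc = λ f g h w → E.trans (two meet _)
                     (E.trans (A.∧-cong (two meet _) E.refl)
                     (E.trans (A.∧-assoc (f w) (g w) (h w))
                     (E.trans (A.∧-cong E.refl (E.sym (two meet _)))
                     (E.sym (two meet _)))))
        ; ∧-cong  = λ e₁ e₂ w → E.trans (two meet _)
                     (E.trans (A.∧-cong (e₁ w) (e₂ w)) (E.sym (two meet _)))
        ; absorptive =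
            (λ f g w → E.trans (two join _)
                        (E.trans (A.∨-cong E.refl (two meet _))
                        (proj₁ A.absorptive (f w) (g w))))
          , (λ f g w → E.trans (two meet _)
                        (E.trans (A.∧-cong E.refl (two join _))
                        (proj₂ A.absorptive (f w) (g w))))
        }
      }

    OpClosed : (Carrier → Set a) → Set a
    OpClosed P = ∀ {n} (o : Op n) (xs : Fin n → Carrier) →
                 (∀ i → P (xs i)) → P (⟦ o ⟧ xs)

    Sub : (P : Carrier → Set a) → OpClosed P → LLattice a
    Sub P cl = record
      { Carrier   = Σ Carrier P
      ; _≈_       = λ x y → proj₁ x ≈ proj₁ y
      ; ⟦_⟧       = λ o xs → ⟦ o ⟧ (λ i → proj₁ (xs i)) , cl o _ (λ i → proj₂ (xs i))
      ; ⟦⟧-cong   = λ o xs ys e → A.⟦⟧-cong o _ _ e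
      ; isLattice = record
        { isEquivalence = record { refl = E.refl ; sym = E.sym ; trans = E.trans }
        ; ∨-comm  = λ f g → E.trans (two join _)
                     (E.trans (A.∨-comm (proj₁ f) (proj₁ g)) (E.sym (two join _)))
        ; ∨-assoc = λ f g h → E.trans (two join _)
                     (E.trans (A.∨-cong (two join _) E.refl)
                     (E.trans (A.∨-assoc (proj₁ f) (proj₁ g) (proj₁ h))
                     (E.trans (A.∨-cong E.refl (E.sym (two join _)))
                     (E.sym (two join _)))))
        ; ∨-cong  = λ e₁ e₂ → E.trans (two join _)
                     (E.trans (A.∨-cong e₁ e₂) (E.sym (two join _)))
        ; ∧-comm  = λ f g → E.trans (two meet _)
                     (E.trans (A.∧-comm (proj₁ f) (proj₁ g)) (E.sym (two meet _)))
        ; ∧-assoc = λ f g h → E.trans (two meet _)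
                     (E.trans (A.∧-cong (two meet _) E.refl)
                     (E.trans (A.∧-assoc (proj₁ f) (proj₁ g) (proj₁ h))
                     (E.trans (A.∧-cong E.refl (E.sym (two meet _)))
                     (E.sym (two meet _)))))
        ; ∧-cong  = λ e₁ e₂ → E.trans (two meet _)
                     (E.trans (A.∧-cong e₁ e₂) (E.sym (two meet _)))
        ; absorptive =
            (λ f g → E.trans (two join _)
                      (E.trans (A.∨-cong E.refl (two meet _))
                      (proj₁ A.absorptive (proj₁ f) (proj₁ g))))
          , (λ f g → E.trans (two meet _)
                      (E.trans (A.∧-cong E.refl (two join _))
                      (proj₂ A.absorptive (proj₁ f) (proj₁ g))))
        }
      }

  SubClosed : ∀ {a k} → (LLattice a → Set k) → Set (lsuc a ⊔ k)
  SubClosed {a} K = ∀ (A : LLattice a) → K A →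
    (P : LLattice.Carrier A → Set a) (cl : OpClosed A P) → K (Sub A P cl)

  PowClosed : ∀ {a k} → (LLattice a → Set k) → Set (lsuc a ⊔ k)
  PowClosed {a} K = ∀ (A : LLattice a) → K A → (W : Set a) → K (Pow A W)

  record MLLattice (a : Level) : Set (lsuc a) where
    field
      lat : LLattice a
    open LLattice lat public
    field
      □      : Carrier → Carrier
      ◇      : Carrier → Carrier
      □-cong : ∀ {x y} → x ≈ y → □ x ≈ □ y
      ◇-cong : ∀ {x y} → x ≈ y → ◇ x ≈ ◇ y
      ax₁    : ∀ x → (□ x ∧ x) ≈ □ x
      ax₂    : ∀ x y → □ (x ∧ y) ≈ (□ x ∧ □ y)
      ax₃    : ∀ x → □ (◇ x) ≈ ◇ x
      ax₄    : ∀ x → (◇ x ∨ x) ≈ ◇ x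
      ax₅    : ∀ x y → ◇ (x ∨ y) ≈ (◇ x ∨ ◇ y)
      ax₆    : ∀ x → ◇ (□ x) ≈ □ x
      ax-op  : ∀ {n} (o : Op n) (xs : Fin n → Carrier) →
               □ (⟦ o ⟧ (λ i → □ (xs i))) ≈ ⟦ o ⟧ (λ i → □ (xs i))

  mClass : ∀ {a k} → (LLattice a → Set k) → MLLattice a → Set k
  mClass K B = K (MLLattice.lat B)

  -- ⟨A,W⟩-functional m-𝓛-lattices: a subalgebra (universe P) of A^W
  -- such that every f ∈ P has a meet and a join in A whose constant
  -- functions lie in P.  □ f / ◇ f are these constant functions.

  record Functional {a} (A : LLattice a) (W : Set a) : Set (lsuc a) where
    open LLattice A
    field
      P      : (W → Carrier) → Set a
      closed : OpClosed (Pow A W) P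
      inf    : ∀ f → P f → Carrier
      isInf  : ∀ f (p : P f) → IsInf f (inf f p)
      sup    : ∀ f → P f → Carrier
      isSup  : ∀ f (p : P f) → IsSup f (sup f p)
      □-in   : ∀ f (p : P f) → P (λ _ → inf f p)
      ◇-in   : ∀ f (p : P f) → P (λ _ → sup f p)

  record IsoFun {a} (B : MLLattice a) {A : LLattice a} {W : Set a}
                (F : Functional A W) : Set a where
    private module B = MLLattice B
    open LLattice A
    open Functional F
    field
      h       : B.Carrier → W → Carrier
      h-in    : ∀ b → P (h b)
      h-cong  : ∀ {x y} → x B.≈ y → ∀ w → h x w ≈ h y w
      h-inj   : ∀ {x y} → (∀ w → h x w ≈ h y w) → x B.≈ y
      h-surj  : ∀ f → P f → Σ[ b ∈ B.Carrier ] (∀ w → h b w ≈ f w)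
      h-op    : ∀ {n} (o : Op n) (xs : Fin n → B.Carrier) →
                ∀ w → h (B.⟦ o ⟧ xs) w ≈ ⟦ o ⟧ (λ i → h (xs i) w)
      h-□     : ∀ b → ∀ w → h (B.□ b) w ≈ inf (h b) (h-in b)
      h-◇     : ∀ b → ∀ w → h (B.◇ b) w ≈ sup (h b) (h-in b)

  KFunctional : ∀ {a k} → (LLattice a → Set k) → MLLattice a → Set (lsuc a ⊔ k)
  KFunctional {a} K B =
    Σ[ A ∈ LLattice a ] (K A × Σ[ W ∈ Set a ] Σ[ F ∈ Functional A W ] IsoFun B F)

  data Fm1 : Set where
    P   : ℕ → Fm1                       -- P i (x)
    op  : ∀ {n} → Op n → (Fin n → Fm1) → Fm1
    all : Fm1 → Fm1
    ex  : Fm1 → Fm1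

  data FmBox : Set where
    var : ℕ → FmBox
    op  : ∀ {n} → Op n → (Fin n → FmBox) → FmBox
    box : FmBox → FmBox
    dia : FmBox → FmBox

  Eq1 : Set
  Eq1 = Fm1 × Fm1

  EqBox : Set
  EqBox = FmBox × FmBox

  tr : Fm1 → FmBox
  tr (P i)     = var i
  tr (op o φs) = op o (λ i → tr (φs i))
  tr (all φ)   = box (tr φ)
  tr (ex φ)    = dia (tr φ)

  trEq : Eq1 → EqBox
  trEq (φ , ψ) = tr φ , tr ψ

  trSet : ∀ {t} → (Eq1 → Set t) → EqBox → Set t
  trSet T e = Σ[ e₀ ∈ Eq1 ] (T e₀ × e ≡ trEq e₀)

  -- Semantics of Fm¹∀(𝓛) in A-structures.
  -- Den S φ f : the (partial) interpretation ⟦φ⟧^S is defined and equals f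
  -- (up to ≈, pointwise).

  module _ {a} (A : LLattice a) where
    open LLattice A

    record PreStructure : Set (lsuc a) where
      field
        S  : Set a
        s₀ : S                          -- S is non-empty
        I  : ℕ → S → Carrier

    module _ (𝓢 : PreStructure) where
      open PreStructure 𝓢

      data Den : Fm1 → (S → Carrier) → Set a where
        den-P   : ∀ {i f} → (∀ u → f u ≈ I i u) → Den (P i) f
        den-op  : ∀ {n} {o : Op n} {φs : Fin n → Fm1} {f}
                  (gs : Fin n → S → Carrier) →
                  (∀ i → Den (φs i) (gs i)) →
                  (∀ u → f u ≈ ⟦ o ⟧ (λ i → gs i u)) → Den (op o φs) f
        den-all : ∀ {φ g f} → Den φ g → (∀ u → IsInf g (f u)) → Den (all φ) f
        den-ex  : ∀ {φ g f} → Den φ g → (∀ u → IsSup g (f u)) → Den (ex φ) f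

      _⊨_ : Eq1 → Set a
      _⊨_ (φ , ψ) = ∀ f g → Den φ f → Den ψ g → ∀ u → f u ≈ g u

    record Structure : Set (lsuc a) where
      field
        pre   : PreStructure
        total : ∀ φ → Σ[ f ∈ (PreStructure.S pre → Carrier) ] Den pre φ f

  Cons∀ : ∀ {a k t} → (LLattice a → Set k) → (Eq1 → Set t) → Eq1 →
          Set (lsuc a ⊔ k ⊔ t)
  Cons∀ {a} K T e = ∀ (A : LLattice a) → K A → (𝓢 : Structure A) →
    (∀ e₀ → T e₀ → _⊨_ A (Structure.pre 𝓢) e₀) → _⊨_ A (Structure.pre 𝓢) e

  module _ {a} (B : MLLattice a) where
    open MLLattice B

    eval : (ℕ → Carrier) → FmBox → Carrier
    eval v (var i)   = v i
    eval v (op o αs) = ⟦ o ⟧ (λ i → eval v (αs i))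
    eval v (box α)   = □ (eval v α)
    eval v (dia α)   = ◇ (eval v α)

  ConsV : ∀ {a k t} → (MLLattice a → Set k) → (EqBox → Set t) → EqBox →
          Set (lsuc a ⊔ k ⊔ t)
  ConsV {a} V Σ₀ (α , β) = ∀ (B : MLLattice a) → V B → (v : ℕ → MLLattice.Carrier B) →
    (∀ α′ β′ → Σ₀ (α′ , β′) → MLLattice._≈_ B (eval B v α′) (eval B v β′)) →
    MLLattice._≈_ B (eval B v α) (eval B v β)

{-# OPTIONS --safe #-}
-- The functions S → A defined by formulas in an A-structure form a
-- subalgebra of the power A^S in which ∀x and ∃x are the pointwise meet
-- and join, i.e. a functional m-𝓛-lattice; closure of K under powers and
-- subalgebras puts it in mK.  Conversely, a representation of an
-- m-𝓛-lattice as functions W → A turns every valuation into an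
-- A-structure with universe W.  In both cases the interpretation of φ is
-- the image of the value of φ*, so an equation holds in the structure
-- exactly when its translation holds under the valuation.
module Submission where

open import Defs
open import Level using (Level; _⊔_)
open import Data.Nat using (ℕ)
open import Data.Fin using (Fin)
open import Data.Product using (_×_; _,_; Σ; proj₁; proj₂)
open import Function.Bundles using (_⇔_; mk⇔; Equivalence)
open import Relation.Binary.Bundles using (Poset)
open import Relation.Binary.Lattice using (Supremum)
import Relation.Binary.Lattice.Bundles as Order
import Relation.Binary.Lattice.Properties.JoinSemilattice as JoinSemilatticeProperties
open import Relation.Binary.Properties.Poset using (≥-poset)
import Relation.Binary.PropositionalEquality as ≡
import Algebra.Lattice.Bundles as Algebraic
import Algebra.Lattice.Properties.Lattice as AlgebraicLatticeProperties

module FamilyBounds {c ℓ₁ ℓ₂} (P : Poset c ℓ₁ ℓ₂) where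
  open Poset P

  IsLub : ∀ {w} {W : Set w} → (W → Carrier) → Carrier → Set (c ⊔ ℓ₂ ⊔ w)
  IsLub f m = (∀ v → f v ≤ m) × (∀ z → (∀ v → f v ≤ z) → m ≤ z)

  module _ {w} {W : Set w} where

    IsLub-unique : ∀ {f : W → Carrier} {m m′} → IsLub f m → IsLub f m′ → m ≈ m′
    IsLub-unique (ub , least) (ub′ , least′) = antisym (least _ ub′) (least′ _ ub)

    IsLub-cong : ∀ {f g : W → Carrier} {m m′} → (∀ v → f v ≈ g v) → m ≈ m′ →
                 IsLub f m → IsLub g m′
    IsLub-cong f≈g m≈m′ (ub , least) =
        (λ v → ≤-respʳ-≈ m≈m′ (≤-respˡ-≈ (f≈g v) (ub v)))
      , (λ z gv≤z → ≤-respˡ-≈ m≈m′ (least z (λ v → ≤-respˡ-≈ (Eq.sym (f≈g v)) (gv≤z v))))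

    IsLub-const : W → ∀ {x m} → IsLub (λ (_ : W) → x) m → m ≈ x
    IsLub-const v (ub , least) = antisym (least _ (λ _ → refl)) (ub v)

    IsLub-pointwise : ∀ {_⊔_} → Supremum _≤_ _⊔_ → ∀ {f g : W → Carrier} {m n} →
                      IsLub f m → IsLub g n → IsLub (λ v → f v ⊔ g v) (m ⊔ n)
    IsLub-pointwise {_⊔_} sup {m = m} {n} (ubf , leastf) (ubg , leastg) =
        (λ v → ⊔-least (trans (ubf v) (x≤x⊔y m n)) (trans (ubg v) (y≤x⊔y m n)))
      , (λ z ub → ⊔-least (leastf z (λ v → trans (x≤x⊔y _ _) (ub v)))
                          (leastg z (λ v → trans (y≤x⊔y _ _) (ub v))))
      where
      x≤x⊔y : ∀ x y → x ≤ x ⊔ y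
      x≤x⊔y x y = proj₁ (sup x y)
      y≤x⊔y : ∀ x y → y ≤ x ⊔ y
      y≤x⊔y x y = proj₁ (proj₂ (sup x y))
      ⊔-least : ∀ {x y z} → x ≤ z → y ≤ z → x ⊔ y ≤ z
      ⊔-least {x} {y} {z} = proj₂ (proj₂ (sup x y)) z

module LatticeOrder {𝓛 : Signature} {a : Level} (A : LLattice 𝓛 a) where
  open LLattice A

  private
    algebraicLattice : Algebraic.Lattice a a
    algebraicLattice = record { isLattice = isLattice }

    module Natural = Order.Lattice
      (AlgebraicLatticeProperties.∨-∧-orderTheoreticLattice algebraicLattice)

  -- The library's natural order is x ≈ x ∧ y; the order of A is its mirror image.
  orderLattice : Order.Lattice a a a
  orderLattice = record
    { _≤_       = _≤_
    ; isLattice = record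
      { isPartialOrder = record
        { isPreorder = record
          { isEquivalence = isEquivalence
          ; reflexive     = λ x≈y → sym (Natural.reflexive x≈y)
          ; trans         = λ x≤y y≤z → sym (Natural.trans (sym x≤y) (sym y≤z))
          }
        ; antisym = λ x≤y y≤x → Natural.antisym (sym x≤y) (sym y≤x)
        }
      ; supremum = λ x y → let (ub₁ , ub₂ , least) = Natural.supremum x y in
          sym ub₁ , sym ub₂ , λ z x≤z y≤z → sym (least z (sym x≤z) (sym y≤z))
      ; infimum  = λ x y → let (lb₁ , lb₂ , greatest) = Natural.infimum x y in
          sym lb₁ , sym lb₂ , λ z z≤x z≤y → sym (greatest z (sym z≤x) (sym z≤y))
      }
    }

  open Order.Lattice orderLattice public using (poset; supremum; infimum)
  open JoinSemilatticeProperties (Order.Lattice.joinSemilattice orderLattice) public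
    using (x≤y⇒x∨y≈y)

  open FamilyBounds poset public using ()
    renaming (IsLub-unique to IsSup-unique; IsLub-cong to IsSup-cong;
              IsLub-const to IsSup-const; IsLub-pointwise to IsSup-pointwise)
  open FamilyBounds (≥-poset poset) public using ()
    renaming (IsLub-unique to IsInf-unique; IsLub-cong to IsInf-cong;
              IsLub-const to IsInf-const; IsLub-pointwise to IsInf-pointwise)

module _ {𝓛 : Signature} {a : Level} {A : LLattice 𝓛 a} (𝓢 : PreStructure 𝓛 A) where
  open LLattice A
  open LatticeOrder A
  open PreStructure 𝓢

  Den-unique : ∀ {χ f g} → Den 𝓛 A 𝓢 χ f → Den 𝓛 A 𝓢 χ g → ∀ u → f u ≈ g u
  Den-unique (den-P f≈I) (den-P g≈I) u = trans (f≈I u) (sym (g≈I u))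
  Den-unique (den-op {o = o} _ ds f≈) (den-op _ ds′ g≈) u =
    trans (f≈ u) (trans (⟦⟧-cong o _ _ (λ i → Den-unique (ds i) (ds′ i) u)) (sym (g≈ u)))
  Den-unique (den-all d inf) (den-all d′ inf′) u =
    IsInf-unique (inf u) (IsInf-cong (λ v → Den-unique d′ d v) refl (inf′ u))
  Den-unique (den-ex d sup) (den-ex d′ sup′) u =
    IsSup-unique (sup u) (IsSup-cong (λ v → Den-unique d′ d v) refl (sup′ u))

  ⊨-intro : ∀ {φ ψ f g} → Den 𝓛 A 𝓢 φ f → Den 𝓛 A 𝓢 ψ g → (∀ u → f u ≈ g u) →
            _⊨_ 𝓛 A 𝓢 (φ , ψ)
  ⊨-intro dφ dψ f≈g f′ g′ dφ′ dψ′ u =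
    trans (Den-unique dφ′ dφ u) (trans (f≈g u) (Den-unique dψ dψ′ u))

functionalMLattice : ∀ {𝓛 : Signature} {a} {A : LLattice 𝓛 a} {W : Set a} →
                     Functional 𝓛 A W → MLLattice 𝓛 a
functionalMLattice {𝓛} {A = A} {W} F = record
  { lat    = functions
  ; □      = □
  ; ◇      = ◇
  ; □-cong = λ {x} {y} x≈y _ →
      IsInf-unique (inf-□ x) (IsInf-cong (λ v → sym (x≈y v)) refl (inf-□ y))
  ; ◇-cong = λ {x} {y} x≈y _ →
      IsSup-unique (sup-◇ x) (IsSup-cong (λ v → sym (x≈y v)) refl (sup-◇ y))
  ; ax₁    = λ x w → trans (two meet _) (proj₁ (inf-□ x) w)
  ; ax₂    = λ x y _ →
      IsInf-unique (IsInf-cong (λ _ → two meet _) refl (inf-□ (x ∧ᶠ y)))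
                   (IsInf-cong (λ _ → refl) (sym (two meet _))
                     (IsInf-pointwise infimum (inf-□ x) (inf-□ y)))
  ; ax₃    = λ x w → IsInf-const w (inf-□ (◇ x))
  ; ax₄    = λ x w →
      trans (two join _) (trans (∨-comm _ _) (x≤y⇒x∨y≈y (proj₁ (sup-◇ x) w)))
  ; ax₅    = λ x y _ →
      IsSup-unique (IsSup-cong (λ _ → two join _) refl (sup-◇ (x ∨ᶠ y)))
                   (IsSup-cong (λ _ → refl) (sym (two join _))
                     (IsSup-pointwise supremum (sup-◇ x) (sup-◇ y)))
  ; ax₆    = λ x w → IsSup-const w (sup-◇ (□ x))
  ; ax-op  = λ o xs w → IsInf-const w (inf-□ (o ⟦ (λ i → □ (xs i)) ⟧ᶠ))
  }
  where
  open Signature 𝓛 using (meet; join)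
  open LLattice A
  open LatticeOrder A
  open Functional F renaming (P to InB)

  functions : LLattice 𝓛 _
  functions = Sub 𝓛 (Pow 𝓛 A W) InB closed
  open LLattice functions using ()
    renaming (Carrier to Elem; _∧_ to _∧ᶠ_; _∨_ to _∨ᶠ_; ⟦_⟧ to _⟦_⟧ᶠ)

  □ ◇ : Elem → Elem
  □ (f , p) = (λ _ → inf f p) , □-in f p
  ◇ (f , p) = (λ _ → sup f p) , ◇-in f p

  inf-□ : ∀ x → IsInf (proj₁ x) (inf (proj₁ x) (proj₂ x))
  inf-□ (f , p) = isInf f p

  sup-◇ : ∀ x → IsSup (proj₁ x) (sup (proj₁ x) (proj₂ x))
  sup-◇ (f , p) = isSup f p

record Representation {𝓛 : Signature} {a} (B : MLLattice 𝓛 a) (A : LLattice 𝓛 a)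
                      (W : Set a) : Set a where
  private module B = MLLattice B
  open LLattice A
  field
    rep    : B.Carrier → W → Carrier
    rep-op : ∀ {n} (o : Signature.Op 𝓛 n) (xs : Fin n → B.Carrier) w →
             rep (B.⟦ o ⟧ xs) w ≈ ⟦ o ⟧ (λ i → rep (xs i) w)
    rep-□  : ∀ b w → IsInf (rep b) (rep (B.□ b) w)
    rep-◇  : ∀ b w → IsSup (rep b) (rep (B.◇ b) w)

functionalRepresentation : ∀ {𝓛 : Signature} {a} {A : LLattice 𝓛 a} {W : Set a}
                           (F : Functional 𝓛 A W) →
                           Representation (functionalMLattice F) A W
functionalRepresentation {A = A} F = record
  { rep    = proj₁
  ; rep-op = λ _ _ _ → refl
  ; rep-□  = λ (f , p) _ → isInf f p
  ; rep-◇  = λ (f , p) _ → isSup f p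
  }
  where
  open LLattice A
  open Functional F

isoRepresentation : ∀ {𝓛 : Signature} {a} {B : MLLattice 𝓛 a} {A : LLattice 𝓛 a}
                    {W : Set a} {F : Functional 𝓛 A W} →
                    IsoFun 𝓛 B F → Representation B A W
isoRepresentation {A = A} {F = F} iso = record
  { rep    = h
  ; rep-op = h-op
  ; rep-□  = λ b w → IsInf-cong (λ _ → refl) (sym (h-□ b w)) (isInf (h b) (h-in b))
  ; rep-◇  = λ b w → IsSup-cong (λ _ → refl) (sym (h-◇ b w)) (isSup (h b) (h-in b))
  }
  where
  open LLattice A
  open LatticeOrder A
  open Functional F
  open IsoFun iso

module _ {𝓛 : Signature} {a} {B : MLLattice 𝓛 a} {A : LLattice 𝓛 a}
         (𝓢 : PreStructure 𝓛 A) (R : Representation B A (PreStructure.S 𝓢))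
         (v : ℕ → MLLattice.Carrier B)
         (rep-v : ∀ i u → LLattice._≈_ A (Representation.rep R (v i) u)
                                          (PreStructure.I 𝓢 i u)) where
  open LLattice A
  open Representation R

  Den-tr : ∀ χ → Den 𝓛 A 𝓢 χ (rep (eval 𝓛 B v (tr 𝓛 χ)))
  Den-tr (P i)     = den-P (rep-v i)
  Den-tr (op o φs) = den-op _ (λ i → Den-tr (φs i)) (rep-op o _)
  Den-tr (all φ)   = den-all (Den-tr φ) (rep-□ _)
  Den-tr (ex φ)    = den-ex (Den-tr φ) (rep-◇ _)

  ⊨⇔rep-≈ : ∀ φ ψ → _⊨_ 𝓛 A 𝓢 (φ , ψ) ⇔
            (∀ u → rep (eval 𝓛 B v (tr 𝓛 φ)) u ≈ rep (eval 𝓛 B v (tr 𝓛 ψ)) u)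
  ⊨⇔rep-≈ φ ψ = mk⇔ (λ sat → sat _ _ (Den-tr φ) (Den-tr ψ))
                    (⊨-intro 𝓢 (Den-tr φ) (Den-tr ψ))

module _ {𝓛 : Signature} {a} {A : LLattice 𝓛 a} (𝓢 : Structure 𝓛 A) where
  open LLattice A
  open LatticeOrder A
  open Structure 𝓢
  open PreStructure pre

  Definable : (S → Carrier) → Set a
  Definable f = Σ (Fm1 𝓛) λ χ → Den 𝓛 A pre χ f

  Definable-closed : OpClosed 𝓛 (Pow 𝓛 A S) Definable
  Definable-closed o fs defs =
    op o (λ i → proj₁ (defs i)) , den-op fs (λ i → proj₂ (defs i)) (λ _ → refl)

  Definable-inf : ∀ {f} → Definable f → Σ Carrier (IsInf f)
  Definable-inf (χ , d) with total (all χ)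
  ... | _ , den-all {f = g} d′ inf = g s₀ , IsInf-cong (Den-unique pre d′ d) refl (inf s₀)

  Definable-sup : ∀ {f} → Definable f → Σ Carrier (IsSup f)
  Definable-sup (χ , d) with total (ex χ)
  ... | _ , den-ex {f = g} d′ sup = g s₀ , IsSup-cong (Den-unique pre d′ d) refl (sup s₀)

  definableFunctional : Functional 𝓛 A S
  definableFunctional = record
    { P      = Definable
    ; closed = Definable-closed
    ; inf    = λ _ def → proj₁ (Definable-inf def)
    ; isInf  = λ _ def → proj₂ (Definable-inf def)
    ; sup    = λ _ def → proj₁ (Definable-sup def)
    ; isSup  = λ _ def → proj₂ (Definable-sup def)
    ; □-in   = λ _ (χ , d) → all χ , den-all d (λ _ → proj₂ (Definable-inf (χ , d)))
    ; ◇-in   = λ _ (χ , d) → ex χ , den-ex d (λ _ → proj₂ (Definable-sup (χ , d)))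
    }

  definableMLattice : MLLattice 𝓛 a
  definableMLattice = functionalMLattice definableFunctional

  definableValuation : ℕ → MLLattice.Carrier definableMLattice
  definableValuation i = I i , P i , den-P (λ _ → refl)

  ⊨⇔definable-≈ : ∀ φ ψ → _⊨_ 𝓛 A pre (φ , ψ) ⇔
                  MLLattice._≈_ definableMLattice
                    (eval 𝓛 definableMLattice definableValuation (tr 𝓛 φ))
                    (eval 𝓛 definableMLattice definableValuation (tr 𝓛 ψ))
  ⊨⇔definable-≈ = ⊨⇔rep-≈ pre (functionalRepresentation definableFunctional)
                          definableValuation (λ _ _ → refl)

module _ {𝓛 : Signature} {a} {B : MLLattice 𝓛 a} {A : LLattice 𝓛 a} {W : Set a}
         (R : Representation B A W) (v : ℕ → MLLattice.Carrier B) where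
  open LLattice A
  open Representation R

  representedPreStructure : W → PreStructure 𝓛 A
  representedPreStructure w = record { S = W ; s₀ = w ; I = λ i → rep (v i) }

  representedStructure : W → Structure 𝓛 A
  representedStructure w = record
    { pre   = representedPreStructure w
    ; total = λ χ → _ , Den-tr (representedPreStructure w) R v (λ _ _ → refl) χ
    }

  ⊨⇔represented-≈ : ∀ w φ ψ → _⊨_ 𝓛 A (representedPreStructure w) (φ , ψ) ⇔
                    (∀ u → rep (eval 𝓛 B v (tr 𝓛 φ)) u ≈ rep (eval 𝓛 B v (tr 𝓛 ψ)) u)
  ⊨⇔represented-≈ w = ⊨⇔rep-≈ (representedPreStructure w) R v (λ _ _ → refl)

module _ {𝓛 : Signature} {a k t} (K : LLattice 𝓛 a → Set k) (T : Eq1 𝓛 → Set t)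
         (φ ψ : Fm1 𝓛) where

  mK-consequence⇒∀-consequence :
    SubClosed 𝓛 K → PowClosed 𝓛 K →
    ConsV 𝓛 (mClass 𝓛 K) (trSet 𝓛 T) (tr 𝓛 φ , tr 𝓛 ψ) → Cons∀ 𝓛 K T (φ , ψ)
  mK-consequence⇒∀-consequence sub pow cons A A∈K 𝓢 𝓢⊨T =
    Equivalence.from (⊨⇔definable-≈ 𝓢 φ ψ)
      (cons (definableMLattice 𝓢) definable∈mK (definableValuation 𝓢) definable⊨T*)
    where
    definable∈mK : mClass 𝓛 K (definableMLattice 𝓢)
    definable∈mK =
      sub _ (pow A A∈K (PreStructure.S (Structure.pre 𝓢))) _ (Definable-closed 𝓢)

    definable⊨T* : ∀ α β → trSet 𝓛 T (α , β) →
                   MLLattice._≈_ (definableMLattice 𝓢)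
                     (eval 𝓛 (definableMLattice 𝓢) (definableValuation 𝓢) α)
                     (eval 𝓛 (definableMLattice 𝓢) (definableValuation 𝓢) β)
    definable⊨T* _ _ ((φ₀ , ψ₀) , φ₀≈ψ₀∈T , ≡.refl) =
      Equivalence.to (⊨⇔definable-≈ 𝓢 φ₀ ψ₀) (𝓢⊨T _ φ₀≈ψ₀∈T)

  ∀-consequence⇒mK-consequence :
    (∀ B → mClass 𝓛 K B → KFunctional 𝓛 K B) →
    Cons∀ 𝓛 K T (φ , ψ) → ConsV 𝓛 (mClass 𝓛 K) (trSet 𝓛 T) (tr 𝓛 φ , tr 𝓛 ψ)
  ∀-consequence⇒mK-consequence functional cons B B∈mK v B⊨T*
    with functional B B∈mK
  -- W may be empty, so the represented structure is only built around a given point w.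
  ... | A , A∈K , W , F , iso = h-inj λ w →
    Equivalence.to (⊨⇔represented-≈ R v w φ ψ)
      (cons A A∈K (representedStructure R v w) (represented⊨T w)) w
    where
    open IsoFun iso

    R : Representation B A W
    R = isoRepresentation iso

    represented⊨T : ∀ w e → T e → _⊨_ 𝓛 A (representedPreStructure R v w) e
    represented⊨T w (φ₀ , ψ₀) φ₀≈ψ₀∈T =
      Equivalence.from (⊨⇔represented-≈ R v w φ₀ ψ₀)
        (h-cong (B⊨T* _ _ ((φ₀ , ψ₀) , φ₀≈ψ₀∈T , ≡.refl)))

corollary3p8 : ∀ {a k t : Level} (𝓛 : Signature) (K : LLattice 𝓛 a → Set k) →
    SubClosed 𝓛 K → PowClosed 𝓛 K →
    (T : Eq1 𝓛 → Set t) (φ ψ : Fm1 𝓛) →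
    (ConsV 𝓛 (mClass 𝓛 K) (trSet 𝓛 T) (tr 𝓛 φ , tr 𝓛 ψ) → Cons∀ 𝓛 K T (φ , ψ))
    × ((∀ (B : MLLattice 𝓛 a) → mClass 𝓛 K B → KFunctional 𝓛 K B) →
       (ConsV 𝓛 (mClass 𝓛 K) (trSet 𝓛 T) (tr 𝓛 φ , tr 𝓛 ψ) ⇔ Cons∀ 𝓛 K T (φ , ψ)))
corollary3p8 𝓛 K sub pow T φ ψ =
    mK-consequence⇒∀-consequence K T φ ψ sub pow
  , λ functional → mk⇔ (mK-consequence⇒∀-consequence K T φ ψ sub pow)
                       (∀-consequence⇒mK-consequence K T φ ψ functional)
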